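{- For integers $n=2^k$ ($k\ge0$), define graphs $\Psi_n$ recursively by $\Psi_1=\overline{K_2}$ (two vertices, no edges) and $\Psi_{2n}$ = the disjoint union of $2^{n-1}$ copies of the join $\Psi_n+\Psi_n$. Let $\Omega_n$ be the graph whose vertices are all $\pm1$-vectors of length $n$, two vertices being adjacent if and only if they are orthogonal. Then \[ \lim_{k\to\infty}\frac{|E(\Psi_{2^k})|}{|E(\Omega_{2^k})|}=0. \]
   Context: The join $X_1+X_2$ of graphs is the disjoint union of $X_1$ and $X_2$ together with all edges between $V(X_1)$ and $V(X_2)$. $E(X)$ denotes the edge set of $X$. -}

module Defs where

open import Data.Nat using (ℕ; zero; suc; _+_; _∸_; _^_)
open import Data.Integer using (ℤ; +_; -[1+_]) renaming (_+_ to _+ℤ_; _*_ to _*ℤ_)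
import Data.Integer as ℤ
open import Data.Bool using (Bool; true; false; if_then_else_)
open import Data.List using (List; []; _∷_; map; _++_; concatMap)
open import Data.Nat.ListAction using (sum)
open import Data.Vec using (Vec; []; _∷_)
open import Data.Sum using (_⊎_; inj₁; inj₂)
open import Data.Empty using (⊥)
open import Relation.Nullary.Decidable using (⌊_⌋)

-- A finite simple graph: a vertex type, an enumeration of its vertices
-- (each vertex listed exactly once), and a (symmetric, irreflexive) Boolean
-- adjacency relation.
record Graph : Set₁ where
  field
    V     : Set
    verts : List V
    adj   : V → V → Bool
open Graph public

pairsCount : {A : Set} → (A → A → Bool) → List A → ℕ
pairsCount a [] = 0
pairsCount a (x ∷ xs) = sum (map (λ y → if a x y then 1 else 0) xs) + pairsCount a xs

edgeCount : Graph → ℕ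
edgeCount G = pairsCount (adj G) (verts G)

emptyGraph : Graph
emptyGraph = record { V = ⊥ ; verts = [] ; adj = λ () }

coK2 : Graph
coK2 = record { V = Bool ; verts = false ∷ true ∷ [] ; adj = λ _ _ → false }

private
  sumAdj : {A B : Set} → (A → A → Bool) → (B → B → Bool) → Bool → A ⊎ B → A ⊎ B → Bool
  sumAdj a b c (inj₁ x) (inj₁ y) = a x y
  sumAdj a b c (inj₂ x) (inj₂ y) = b x y
  sumAdj a b c (inj₁ x) (inj₂ y) = c
  sumAdj a b c (inj₂ x) (inj₁ y) = c

  combine : Bool → Graph → Graph → Graph
  combine c G H = record
    { V = V G ⊎ V H
    ; verts = map inj₁ (verts G) ++ map inj₂ (verts H)
    ; adj = sumAdj (adj G) (adj H) c }

_⊕_ : Graph → Graph → Graph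
_⊕_ = combine false

_⋈_ : Graph → Graph → Graph
_⋈_ = combine true

copies : ℕ → Graph → Graph
copies zero    G = emptyGraph
copies (suc m) G = G ⊕ copies m G

-- Ψ k  is  Ψ_{2^k}:  Ψ_1 = co-K₂,  Ψ_{2n} = 2^{n-1} copies of (Ψ_n + Ψ_n), n = 2^k
Ψ : ℕ → Graph
Ψ zero    = coK2
Ψ (suc k) = copies (2 ^ (2 ^ k ∸ 1)) (Ψ k ⋈ Ψ k)

pmVecs : (n : ℕ) → List (Vec ℤ n)
pmVecs zero    = [] ∷ []
pmVecs (suc n) = concatMap (λ v → (+ 1 ∷ v) ∷ (-[1+ 0 ] ∷ v) ∷ []) (pmVecs n)

dot : {n : ℕ} → Vec ℤ n → Vec ℤ n → ℤ
dot []       []       = + 0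
dot (x ∷ xs) (y ∷ ys) = x *ℤ y +ℤ dot xs ys

Ω : ℕ → Graph
Ω n = record
  { V = Vec ℤ n
  ; verts = pmVecs n
  ; adj = λ u v → ⌊ dot u v ℤ.≟ + 0 ⌋ }

{-# OPTIONS --safe #-}
-- Let n = 2^(k+1). The graph Ψ_n has 2^n vertices and consists of copies of joins of two graphs
-- on 2^(n/2) vertices, so |E(Ψ_n)| ≤ 2^n · 2^(n/2). In Ω_n the number of v with u · v = 0 is,
-- for every ±1-vector u, the number of ±1-sequences of length n with sum 0, so counting ordered
-- pairs gives 2|E(Ω_n)| + 2^n ≥ 2^n · C(n, n/2). The number of zero-sum sequences is
-- supermultiplicative in the length, hence C(8m, 4m) ≥ C(8, 4)^m = 70^m, while 2^(n/2) = 16^m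
-- for n = 8m: the ratio of edge counts is O((16/70)^m).
module Submission where

open import Defs
open import Data.Nat using (ℕ; _≤_; _^_; NonZero)
open import Data.Integer using (+_)
open import Data.Rational using (ℚ; Positive; _/_; _<_)
open import Data.Product using (Σ; ∃-syntax)

open import Data.Bool using (Bool; true; false; if_then_else_)
open import Data.Integer.Base as ℤ using (ℤ; -[1+_])
import Data.Integer.Properties as ℤ
import Data.Integer.Tactic.RingSolver as ℤ-Ring
open import Data.List using (List; []; _∷_; map; _++_; length; concatMap)
open import Data.List.Properties using (map-++; map-∘; map-cong; length-++; length-map)
open import Data.List.Relation.Unary.All as All using (All; []; _∷_)
open import Data.List.Relation.Unary.All.Properties using (map⁺; concat⁺)
open import Data.Nat as ℕ using (zero; suc; _+_; _*_; _∸_; z≤n; s≤s; z<s; >-nonZero)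
open import Data.Nat.ListAction using (sum)
open import Data.Nat.ListAction.Properties using (sum-++)
open import Data.Nat.Properties
open import Data.Nat.Tactic.RingSolver using (solve-∀)
import Data.Rational.Base as ℚ
import Data.Rational.Properties as ℚ
import Data.Rational.Unnormalised.Base as ℚᵘ
import Data.Rational.Unnormalised.Properties as ℚᵘ
open import Data.Product using (_,_)
open import Data.Sum using (_⊎_; inj₁; inj₂)
open import Data.Vec using (Vec; []; _∷_)
open import Function.Bundles using (_⇔_; mk⇔)
open import Relation.Binary.PropositionalEquality
  using (_≡_; refl; sym; trans; cong; cong₂; subst; subst₂; module ≡-Reasoning)
open import Relation.Nullary.Decidable using (Dec; ⌊_⌋; yes; no; isYes≗does; does-⇔)
open import Algebra.Properties.CommutativeSemigroup ℤ.+-commutativeSemigroup using (xy∙z≈xz∙y)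

private
  variable
    A B C D : Set

-- Sums over lists

𝟙 : Bool → ℕ
𝟙 b = if b then 1 else 0

𝟙≤1 : ∀ b → 𝟙 b ≤ 1
𝟙≤1 true  = ≤-refl
𝟙≤1 false = z≤n

sum-map-++ : (f : A → ℕ) (xs ys : List A) →
             sum (map f (xs ++ ys)) ≡ sum (map f xs) + sum (map f ys)
sum-map-++ f xs ys = trans (cong sum (map-++ f xs ys)) (sum-++ (map f xs) (map f ys))

sum-map-+ : (f g : A → ℕ) (xs : List A) →
            sum (map (λ x → f x + g x) xs) ≡ sum (map f xs) + sum (map g xs)
sum-map-+ f g []       = refl
sum-map-+ f g (x ∷ xs) =
  trans (cong (λ s → f x + g x + s) (sum-map-+ f g xs)) (+-interchange (f x) (g x) _ _)
  where
  +-interchange : ∀ a b c d → a + b + (c + d) ≡ a + c + (b + d)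
  +-interchange = solve-∀

sum-map-cong : {f g : A → ℕ} → (∀ x → f x ≡ g x) → (xs : List A) →
               sum (map f xs) ≡ sum (map g xs)
sum-map-cong f≗g xs = cong sum (map-cong f≗g xs)

sum-map-All : {f : A → ℕ} {c : ℕ} {xs : List A} →
              All (λ x → f x ≡ c) xs → sum (map f xs) ≡ length xs * c
sum-map-All []          = refl
sum-map-All (fx≡c ∷ h) = cong₂ _+_ fx≡c (sum-map-All h)

sum-map-const : (c : ℕ) (xs : List A) → sum (map (λ _ → c) xs) ≡ length xs * c
sum-map-const c xs = sum-map-All {xs = xs} (All.tabulate (λ _ → refl))

sum-map-𝟙≤length : (p : A → Bool) (xs : List A) → sum (map (λ x → 𝟙 (p x)) xs) ≤ length xs
sum-map-𝟙≤length p []       = z≤n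
sum-map-𝟙≤length p (x ∷ xs) = +-mono-≤ (𝟙≤1 (p x)) (sum-map-𝟙≤length p xs)

module _ (g h : A → B) where

  sum-map-concatMap-pair : (f : B → ℕ) (xs : List A) →
    sum (map f (concatMap (λ x → g x ∷ h x ∷ []) xs)) ≡ sum (map (λ x → f (g x) + f (h x)) xs)
  sum-map-concatMap-pair f []       = refl
  sum-map-concatMap-pair f (x ∷ xs) =
    trans (cong (λ s → f (g x) + (f (h x) + s)) (sum-map-concatMap-pair f xs))
          (sym (+-assoc (f (g x)) (f (h x)) _))

  length-concatMap-pair : (xs : List A) →
    length (concatMap (λ x → g x ∷ h x ∷ []) xs) ≡ 2 * length xs
  length-concatMap-pair []       = refl
  length-concatMap-pair (x ∷ xs) =
    trans (cong (λ l → 2 + l) (length-concatMap-pair xs)) (sym (*-distribˡ-+ 2 1 (length xs)))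

-- Counting adjacent pairs

crossCount : (A → B → Bool) → List A → List B → ℕ
crossCount a xs ys = sum (map (λ x → sum (map (λ y → 𝟙 (a x y)) ys)) xs)

pairsCount-map : (a : C → C → Bool) (f : A → C) (xs : List A) →
                 pairsCount a (map f xs) ≡ pairsCount (λ x y → a (f x) (f y)) xs
pairsCount-map a f []       = refl
pairsCount-map a f (x ∷ xs) = cong₂ _+_ (cong sum (sym (map-∘ xs))) (pairsCount-map a f xs)

crossCount-map : (a : C → D → Bool) (f : A → C) (g : B → D) (xs : List A) (ys : List B) →
                 crossCount a (map f xs) (map g ys) ≡ crossCount (λ x y → a (f x) (g y)) xs ys
crossCount-map a f g xs ys =
  trans (cong sum (sym (map-∘ xs))) (sum-map-cong (λ x → cong sum (sym (map-∘ ys))) xs)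

crossCount-const : (b : Bool) (xs : List A) (ys : List B) →
                   crossCount (λ _ _ → b) xs ys ≡ length xs * (length ys * 𝟙 b)
crossCount-const b xs ys =
  trans (sum-map-cong (λ _ → sum-map-const (𝟙 b) ys) xs) (sum-map-const _ xs)

module _ (a : A → A → Bool) where

  pairsCount-++ : (xs ys : List A) →
                  pairsCount a (xs ++ ys) ≡ pairsCount a xs + pairsCount a ys + crossCount a xs ys
  pairsCount-++ []       ys = sym (+-identityʳ _)
  pairsCount-++ (x ∷ xs) ys =
    trans (cong₂ _+_ (sum-map-++ row xs ys) (pairsCount-++ xs ys))
          (regroup (sum (map row xs)) (sum (map row ys)) (pairsCount a xs) (pairsCount a ys) _)
    where
    row : A → ℕ
    row y = 𝟙 (a x y)
    regroup : ∀ r s p q c → r + s + (p + q + c) ≡ r + p + q + (s + c)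
    regroup = solve-∀

  pairsCount-≤ : (xs : List A) → 2 * pairsCount a xs ≤ length xs * length xs
  pairsCount-≤ []       = z≤n
  pairsCount-≤ (x ∷ xs) = begin
    2 * (r + pairsCount a xs)        ≡⟨ *-distribˡ-+ 2 r _ ⟩
    2 * r + 2 * pairsCount a xs      ≤⟨ +-mono-≤ (*-monoʳ-≤ 2 (sum-map-𝟙≤length (a x) xs)) (pairsCount-≤ xs) ⟩
    2 * l + l * l                    ≤⟨ n≤1+n _ ⟩
    suc (2 * l + l * l)              ≡⟨ square-suc l ⟩
    suc l * suc l                    ∎
    where
    open ≤-Reasoning
    r : ℕ
    r = sum (map (λ y → 𝟙 (a x y)) xs)
    l : ℕ
    l = length xs
    square-suc : ∀ l → suc (2 * l + l * l) ≡ suc l * suc l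
    square-suc = solve-∀

  crossCount-self-≤ : (∀ x y → a x y ≡ a y x) → (xs : List A) →
                      crossCount a xs xs ≤ 2 * pairsCount a xs + length xs
  crossCount-self-≤ a-sym []       = z≤n
  crossCount-self-≤ a-sym (x ∷ xs) = begin
    (𝟙 (a x x) + r) + sum (map (λ z → 𝟙 (a z x) + sum (map (λ y → 𝟙 (a z y)) xs)) xs)
      ≡⟨ cong (λ s → 𝟙 (a x x) + r + s) (sum-map-+ (λ z → 𝟙 (a z x)) _ xs) ⟩
    (𝟙 (a x x) + r) + (sum (map (λ z → 𝟙 (a z x)) xs) + crossCount a xs xs)
      ≡⟨ cong (λ s → 𝟙 (a x x) + r + (s + crossCount a xs xs))
              (sum-map-cong (λ z → cong 𝟙 (a-sym z x)) xs) ⟩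
    (𝟙 (a x x) + r) + (r + crossCount a xs xs)
      ≤⟨ +-mono-≤ (+-monoˡ-≤ r (𝟙≤1 (a x x))) (+-monoʳ-≤ r (crossCount-self-≤ a-sym xs)) ⟩
    (1 + r) + (r + (2 * pairsCount a xs + length xs))
      ≡⟨ regroup r (pairsCount a xs) (length xs) ⟩
    2 * (r + pairsCount a xs) + suc (length xs) ∎
    where
    open ≤-Reasoning
    r : ℕ
    r = sum (map (λ y → 𝟙 (a x y)) xs)
    regroup : ∀ r p l → (1 + r) + (r + (2 * p + l)) ≡ 2 * (r + p) + (1 + l)
    regroup = solve-∀

length-map-inj-++ : (xs : List A) (ys : List B) →
                    length (map inj₁ xs ++ map inj₂ ys) ≡ length xs + length ys
length-map-inj-++ xs ys =
  trans (length-++ (map inj₁ xs)) (cong₂ _+_ (length-map inj₁ xs) (length-map inj₂ ys))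

pairsCount-⊎ : (a : A ⊎ B → A ⊎ B → Bool) (xs : List A) (ys : List B) →
               pairsCount a (map inj₁ xs ++ map inj₂ ys)
               ≡ pairsCount (λ x y → a (inj₁ x) (inj₁ y)) xs
                 + pairsCount (λ x y → a (inj₂ x) (inj₂ y)) ys
                 + crossCount (λ x y → a (inj₁ x) (inj₂ y)) xs ys
pairsCount-⊎ a xs ys = trans (pairsCount-++ a (map inj₁ xs) (map inj₂ ys))
  (cong₂ _+_ (cong₂ _+_ (pairsCount-map a inj₁ xs) (pairsCount-map a inj₂ ys))
             (crossCount-map a inj₁ inj₂ xs ys))

vertexCount : Graph → ℕ
vertexCount G = length (verts G)

vertexCount-⊕ : ∀ G H → vertexCount (G ⊕ H) ≡ vertexCount G + vertexCount H
vertexCount-⊕ G H = length-map-inj-++ (verts G) (verts H)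

vertexCount-⋈ : ∀ G H → vertexCount (G ⋈ H) ≡ vertexCount G + vertexCount H
vertexCount-⋈ G H = length-map-inj-++ (verts G) (verts H)

edgeCount-⊕ : ∀ G H → edgeCount (G ⊕ H) ≡ edgeCount G + edgeCount H
edgeCount-⊕ G H = begin
  edgeCount (G ⊕ H)
    ≡⟨ pairsCount-⊎ (adj (G ⊕ H)) (verts G) (verts H) ⟩
  edgeCount G + edgeCount H + crossCount (λ _ _ → false) (verts G) (verts H)
    ≡⟨ cong (λ c → edgeCount G + edgeCount H + c) (crossCount-const false (verts G) (verts H)) ⟩
  edgeCount G + edgeCount H + vertexCount G * (vertexCount H * 0)
    ≡⟨ cong (λ c → edgeCount G + edgeCount H + c)
            (trans (cong (vertexCount G *_) (*-zeroʳ (vertexCount H))) (*-zeroʳ (vertexCount G))) ⟩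
  edgeCount G + edgeCount H + 0
    ≡⟨ +-identityʳ _ ⟩
  edgeCount G + edgeCount H ∎
  where open ≡-Reasoning

edgeCount-⋈ : ∀ G H → edgeCount (G ⋈ H) ≡ edgeCount G + edgeCount H + vertexCount G * vertexCount H
edgeCount-⋈ G H = begin
  edgeCount (G ⋈ H)
    ≡⟨ pairsCount-⊎ (adj (G ⋈ H)) (verts G) (verts H) ⟩
  edgeCount G + edgeCount H + crossCount (λ _ _ → true) (verts G) (verts H)
    ≡⟨ cong (λ c → edgeCount G + edgeCount H + c) (crossCount-const true (verts G) (verts H)) ⟩
  edgeCount G + edgeCount H + vertexCount G * (vertexCount H * 1)
    ≡⟨ cong (λ c → edgeCount G + edgeCount H + vertexCount G * c) (*-identityʳ (vertexCount H)) ⟩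
  edgeCount G + edgeCount H + vertexCount G * vertexCount H ∎
  where open ≡-Reasoning

vertexCount-copies : ∀ m G → vertexCount (copies m G) ≡ m * vertexCount G
vertexCount-copies zero    G = refl
vertexCount-copies (suc m) G =
  trans (vertexCount-⊕ G (copies m G)) (cong (λ n → vertexCount G + n) (vertexCount-copies m G))

edgeCount-copies : ∀ m G → edgeCount (copies m G) ≡ m * edgeCount G
edgeCount-copies zero    G = refl
edgeCount-copies (suc m) G =
  trans (edgeCount-⊕ G (copies m G)) (cong (λ e → edgeCount G + e) (edgeCount-copies m G))

-- Vertex and edge counts of Ψ

2^[2^k∸1]*2≡2^2^k : ∀ k → 2 ^ (2 ^ k ∸ 1) * 2 ≡ 2 ^ 2 ^ k
2^[2^k∸1]*2≡2^2^k k =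
  trans (sym (^-distribˡ-+-* 2 (2 ^ k ∸ 1) 1)) (cong (2 ^_) (m∸n+n≡m (m^n>0 2 k)))

2^2^[1+k]≡[2^2^k]² : ∀ k → 2 ^ 2 ^ suc k ≡ 2 ^ 2 ^ k * 2 ^ 2 ^ k
2^2^[1+k]≡[2^2^k]² k =
  trans (cong (λ n → 2 ^ (2 ^ k + n)) (+-identityʳ (2 ^ k))) (^-distribˡ-+-* 2 (2 ^ k) (2 ^ k))

vertexCount-Ψ-suc : ∀ k →
  vertexCount (Ψ (suc k)) ≡ 2 ^ (2 ^ k ∸ 1) * (vertexCount (Ψ k) + vertexCount (Ψ k))
vertexCount-Ψ-suc k =
  trans (vertexCount-copies c (Ψ k ⋈ Ψ k)) (cong (c *_) (vertexCount-⋈ (Ψ k) (Ψ k)))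
  where
  c : ℕ
  c = 2 ^ (2 ^ k ∸ 1)

vertexCount-Ψ : ∀ k → vertexCount (Ψ k) ≡ 2 ^ 2 ^ k
vertexCount-Ψ zero    = refl
vertexCount-Ψ (suc k) = begin
  vertexCount (Ψ (suc k))             ≡⟨ vertexCount-Ψ-suc k ⟩
  c * (vertexCount (Ψ k) + vertexCount (Ψ k))
    ≡⟨ cong (λ v → c * (v + v)) (vertexCount-Ψ k) ⟩
  c * (2 ^ 2 ^ k + 2 ^ 2 ^ k)         ≡⟨ regroup c (2 ^ 2 ^ k) ⟩
  c * 2 * 2 ^ 2 ^ k                   ≡⟨ cong (_* 2 ^ 2 ^ k) (2^[2^k∸1]*2≡2^2^k k) ⟩
  2 ^ 2 ^ k * 2 ^ 2 ^ k               ≡⟨ 2^2^[1+k]≡[2^2^k]² k ⟨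
  2 ^ 2 ^ suc k                       ∎
  where
  open ≡-Reasoning
  c : ℕ
  c = 2 ^ (2 ^ k ∸ 1)
  regroup : ∀ c w → c * (w + w) ≡ c * 2 * w
  regroup = solve-∀

edgeCount-Ψ-suc-≤ : ∀ k → edgeCount (Ψ (suc k)) ≤ vertexCount (Ψ (suc k)) * vertexCount (Ψ k)
edgeCount-Ψ-suc-≤ k = begin
  edgeCount (copies c (Ψ k ⋈ Ψ k))  ≡⟨ edgeCount-copies c (Ψ k ⋈ Ψ k) ⟩
  c * edgeCount (Ψ k ⋈ Ψ k)         ≡⟨ cong (c *_) (edgeCount-⋈ (Ψ k) (Ψ k)) ⟩
  c * (e + e + v * v)               ≡⟨ cong (λ d → c * (e + d + v * v)) (+-identityʳ e) ⟨
  c * (2 * e + v * v)               ≤⟨ *-monoʳ-≤ c (+-monoˡ-≤ (v * v) (pairsCount-≤ (adj (Ψ k)) (verts (Ψ k)))) ⟩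
  c * (v * v + v * v)               ≡⟨ regroup c v ⟩
  c * (v + v) * v                   ≡⟨ cong (_* v) (vertexCount-Ψ-suc k) ⟨
  vertexCount (Ψ (suc k)) * v       ∎
  where
  open ≤-Reasoning
  c : ℕ
  c = 2 ^ (2 ^ k ∸ 1)
  e : ℕ
  e = edgeCount (Ψ k)
  v : ℕ
  v = vertexCount (Ψ k)
  regroup : ∀ c v → c * (v * v + v * v) ≡ c * (v + v) * v
  regroup = solve-∀

-- Orthogonal pairs of ±1-vectors

-- walks n t is the number of ±1-sequences of length n with sum t, so walks (2 * m) (+ 0) = C(2m, m).
walks : ℕ → ℤ → ℕ
walks zero    t = 𝟙 ⌊ + 0 ℤ.≟ t ⌋
walks (suc n) t = walks n (t ℤ.- + 1) + walks n (t ℤ.+ + 1)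

walks-*-≤ : ∀ a b s t → walks a s * walks b t ≤ walks (a + b) (s ℤ.+ t)
walks-*-≤ zero b s t with + 0 ℤ.≟ s
... | yes refl = ≤-reflexive (trans (+-identityʳ _) (cong (walks b) (sym (ℤ.+-identityˡ t))))
... | no _     = z≤n
walks-*-≤ (suc a) b s t = begin
  (walks a (s ℤ.- + 1) + walks a (s ℤ.+ + 1)) * walks b t
    ≡⟨ *-distribʳ-+ (walks b t) (walks a (s ℤ.- + 1)) _ ⟩
  walks a (s ℤ.- + 1) * walks b t + walks a (s ℤ.+ + 1) * walks b t
    ≤⟨ +-mono-≤ (walks-*-≤ a b _ t) (walks-*-≤ a b _ t) ⟩
  walks (a + b) ((s ℤ.- + 1) ℤ.+ t) + walks (a + b) ((s ℤ.+ + 1) ℤ.+ t)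
    ≡⟨ cong₂ _+_ (cong (walks (a + b)) (xy∙z≈xz∙y s _ t)) (cong (walks (a + b)) (xy∙z≈xz∙y s _ t)) ⟩
  walks (suc a + b) (s ℤ.+ t) ∎
  where open ≤-Reasoning

walks-^-≤ : ∀ a m → walks a (+ 0) ^ m ≤ walks (m * a) (+ 0)
walks-^-≤ a zero    = ≤-refl
walks-^-≤ a (suc m) = ≤-trans (*-monoʳ-≤ (walks a (+ 0)) (walks-^-≤ a m)) (walks-*-≤ a (m * a) (+ 0) (+ 0))

⌊⌋-⇔ : {P Q : Set} → P ⇔ Q → (p? : Dec P) (q? : Dec Q) → ⌊ p? ⌋ ≡ ⌊ q? ⌋
⌊⌋-⇔ P⇔Q p? q? = trans (isYes≗does p?) (trans (does-⇔ P⇔Q p? q?) (sym (isYes≗does q?)))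

𝟙-shift : ∀ a d t → 𝟙 ⌊ a ℤ.+ d ℤ.≟ t ⌋ ≡ 𝟙 ⌊ d ℤ.≟ t ℤ.- a ⌋
𝟙-shift a d t = cong 𝟙 (⌊⌋-⇔ (mk⇔ to from) (a ℤ.+ d ℤ.≟ t) (d ℤ.≟ t ℤ.- a))
  where
  d≡[a+d]-a : ∀ a d → d ≡ (a ℤ.+ d) ℤ.- a
  d≡[a+d]-a = ℤ-Ring.solve-∀
  a+[t-a]≡t : ∀ a t → a ℤ.+ (t ℤ.- a) ≡ t
  a+[t-a]≡t = ℤ-Ring.solve-∀
  to : a ℤ.+ d ≡ t → d ≡ t ℤ.- a
  to eq = trans (d≡[a+d]-a a d) (cong (ℤ._- a) eq)
  from : d ≡ t ℤ.- a → a ℤ.+ d ≡ t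
  from eq = trans (cong (λ e → a ℤ.+ e) eq) (a+[t-a]≡t a t)

dot-comm : ∀ {n} (u v : Vec ℤ n) → dot u v ≡ dot v u
dot-comm []      []      = refl
dot-comm (x ∷ u) (y ∷ v) = cong₂ ℤ._+_ (ℤ.*-comm x y) (dot-comm u v)

length-pmVecs : ∀ n → length (pmVecs n) ≡ 2 ^ n
length-pmVecs zero    = refl
length-pmVecs (suc n) =
  trans (length-concatMap-pair (+ 1 ∷_) (-[1+ 0 ] ∷_) (pmVecs n)) (cong (2 *_) (length-pmVecs n))

dotCount : ∀ {n} → Vec ℤ n → ℤ → ℕ
dotCount {n} u t = sum (map (λ v → 𝟙 ⌊ dot u v ℤ.≟ t ⌋) (pmVecs n))

-- For x = ± 1 the two shifted targets compute to t ∓ 1 and t ± 1.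
dotCount-∷ : ∀ {n} x (u : Vec ℤ n) t →
             dotCount (x ∷ u) t ≡ dotCount u (t ℤ.- x ℤ.* + 1) + dotCount u (t ℤ.- x ℤ.* -[1+ 0 ])
dotCount-∷ {n} x u t = begin
  dotCount (x ∷ u) t
    ≡⟨ sum-map-concatMap-pair (+ 1 ∷_) (-[1+ 0 ] ∷_) (λ w → 𝟙 ⌊ dot (x ∷ u) w ℤ.≟ t ⌋) (pmVecs n) ⟩
  sum (map (λ v → 𝟙 ⌊ x ℤ.* + 1 ℤ.+ dot u v ℤ.≟ t ⌋ + 𝟙 ⌊ x ℤ.* -[1+ 0 ] ℤ.+ dot u v ℤ.≟ t ⌋) (pmVecs n))
    ≡⟨ sum-map-cong (λ v → cong₂ _+_ (𝟙-shift _ (dot u v) t) (𝟙-shift _ (dot u v) t)) (pmVecs n) ⟩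
  sum (map (λ v → 𝟙 ⌊ dot u v ℤ.≟ t ℤ.- x ℤ.* + 1 ⌋ + 𝟙 ⌊ dot u v ℤ.≟ t ℤ.- x ℤ.* -[1+ 0 ] ⌋) (pmVecs n))
    ≡⟨ sum-map-+ _ _ (pmVecs n) ⟩
  dotCount u (t ℤ.- x ℤ.* + 1) + dotCount u (t ℤ.- x ℤ.* -[1+ 0 ]) ∎
  where open ≡-Reasoning

dotCount-pmVecs : ∀ n → All (λ u → ∀ t → dotCount u t ≡ walks n t) (pmVecs n)
dotCount-pmVecs zero    = (λ t → +-identityʳ _) ∷ []
dotCount-pmVecs (suc n) = concat⁺ (map⁺ (All.map both-signs (dotCount-pmVecs n)))
  where
  both-signs : ∀ {v} → (∀ t → dotCount v t ≡ walks n t) →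
               All (λ u → ∀ t → dotCount u t ≡ walks (suc n) t) ((+ 1 ∷ v) ∷ (-[1+ 0 ] ∷ v) ∷ [])
  both-signs {v} h =
      (λ t → trans (dotCount-∷ (+ 1) v t) (cong₂ _+_ (h _) (h _)))
    ∷ (λ t → trans (dotCount-∷ -[1+ 0 ] v t) (trans (cong₂ _+_ (h _) (h _)) (+-comm (walks n (t ℤ.+ + 1)) _)))
    ∷ []

walks-≤-edgeCount-Ω : ∀ n → 2 ^ n * walks n (+ 0) ≤ 2 * edgeCount (Ω n) + 2 ^ n
walks-≤-edgeCount-Ω n = begin
  2 ^ n * walks n (+ 0)
    ≡⟨ cong (_* walks n (+ 0)) (length-pmVecs n) ⟨
  length (pmVecs n) * walks n (+ 0)
    ≡⟨ sum-map-All (All.map (λ h → h (+ 0)) (dotCount-pmVecs n)) ⟨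
  crossCount (adj (Ω n)) (pmVecs n) (pmVecs n)
    ≤⟨ crossCount-self-≤ (adj (Ω n)) (λ u v → cong (λ d → ⌊ d ℤ.≟ + 0 ⌋) (dot-comm u v)) (pmVecs n) ⟩
  2 * edgeCount (Ω n) + length (pmVecs n)
    ≡⟨ cong (λ l → 2 * edgeCount (Ω n) + l) (length-pmVecs n) ⟩
  2 * edgeCount (Ω n) + 2 ^ n ∎
  where open ≤-Reasoning

-- The final estimate

n<2^n : ∀ n → n ℕ.< 2 ^ n
n<2^n zero    = z<s
n<2^n (suc n) = begin-strict
  suc n                ≤⟨ n<2^n n ⟩
  2 ^ n                <⟨ m<m+n (2 ^ n) (≤-trans (m^n>0 2 n) (m≤m+n (2 ^ n) 0)) ⟩
  2 ^ n + (2 ^ n + 0)  ∎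
  where open ≤-Reasoning

2N+2≤4^2^j : ∀ N j → 2 * N + 2 ≤ j → 2 * N + 2 ≤ 4 ^ 2 ^ j
2N+2≤4^2^j N j 2N+2≤j = begin
  2 * N + 2    ≤⟨ 2N+2≤j ⟩
  j            ≤⟨ <⇒≤ (n<2^n j) ⟩
  2 ^ j        ≤⟨ <⇒≤ (n<2^n (2 ^ j)) ⟩
  2 ^ 2 ^ j    ≤⟨ ^-monoˡ-≤ (2 ^ j) (m≤m+n 2 2) ⟩
  4 ^ 2 ^ j    ∎
  where open ≤-Reasoning

^-distribʳ-* : ∀ m n o → (m * n) ^ o ≡ m ^ o * n ^ o
^-distribʳ-* m n zero    = refl
^-distribʳ-* m n (suc o) =
  trans (cong (m * n *_) (^-distribʳ-* m n o)) (interchange m n (m ^ o) (n ^ o))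
  where
  interchange : ∀ a b c d → a * b * (c * d) ≡ a * c * (b * d)
  interchange = solve-∀

2[N*16^m+1]≤70^m : ∀ N m → 2 * N + 2 ≤ 4 ^ m → 2 * (N * 16 ^ m + 1) ≤ 70 ^ m
2[N*16^m+1]≤70^m N m 2N+2≤4^m = begin
  2 * (N * 16 ^ m + 1)              ≡⟨ regroup N (16 ^ m) ⟩
  2 * N * 16 ^ m + 2                ≤⟨ +-monoʳ-≤ (2 * N * 16 ^ m) (*-monoʳ-≤ 2 (m^n>0 16 m)) ⟩
  2 * N * 16 ^ m + 2 * 16 ^ m       ≡⟨ *-distribʳ-+ (16 ^ m) (2 * N) 2 ⟨
  (2 * N + 2) * 16 ^ m              ≤⟨ *-monoˡ-≤ (16 ^ m) 2N+2≤4^m ⟩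
  4 ^ m * 16 ^ m                    ≡⟨ ^-distribʳ-* 4 16 m ⟨
  64 ^ m                            ≤⟨ ^-monoˡ-≤ m (m≤m+n 64 6) ⟩
  70 ^ m                            ∎
  where
  open ≤-Reasoning
  regroup : ∀ N x → 2 * (N * x + 1) ≡ 2 * N * x + 2
  regroup = solve-∀

N*e<E : ∀ N {e E v C} → 0 ℕ.< v → e ≤ v * v * v → v * v * C ≤ 2 * E + v * v →
        2 * (N * v + 1) ≤ C → N * e ℕ.< E
N*e<E N {e} {E} {v} {C} v>0 e≤vvv vvC≤2E+vv 2[Nv+1]≤C = *-cancelˡ-< 2 (N * e) E (begin-strict
  2 * (N * e)                    ≤⟨ *-monoʳ-≤ 2 (*-monoʳ-≤ N e≤vvv) ⟩
  2 * (N * (v * v * v))          <⟨ m<m+n _ (*-mono-< v>0 v>0) ⟩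
  2 * (N * (v * v * v)) + v * v  ≤⟨ +-cancelʳ-≤ (v * v) _ _ 2Nvvv+2vv≤2E+vv ⟩
  2 * E                          ∎)
  where
  open ≤-Reasoning
  regroup : ∀ N v → 2 * (N * (v * v * v)) + v * v + v * v ≡ v * v * (2 * (N * v + 1))
  regroup = solve-∀
  2Nvvv+2vv≤2E+vv : 2 * (N * (v * v * v)) + v * v + v * v ≤ 2 * E + v * v
  2Nvvv+2vv≤2E+vv = begin
    2 * (N * (v * v * v)) + v * v + v * v  ≡⟨ regroup N v ⟩
    v * v * (2 * (N * v + 1))              ≤⟨ *-monoʳ-≤ (v * v) 2[Nv+1]≤C ⟩
    v * v * C                              ≤⟨ vvC≤2E+vv ⟩
    2 * E + v * v                          ∎

N*edgeCount-Ψ<edgeCount-Ω : ∀ N j → 2 * N + 2 ≤ 4 ^ 2 ^ j →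
                            N * edgeCount (Ψ (3 + j)) ℕ.< edgeCount (Ω (2 ^ (3 + j)))
N*edgeCount-Ψ<edgeCount-Ω N j 2N+2≤4^m = N*e<E N v>0 e≤vvv vvC≤2E+vv 2[Nv+1]≤C
  where
  m : ℕ
  m = 2 ^ j
  n : ℕ
  n = 2 ^ (3 + j)
  v : ℕ
  v = vertexCount (Ψ (2 + j))
  W : ℕ
  W = vertexCount (Ψ (3 + j))
  W≡vv : W ≡ v * v
  W≡vv = begin
    W                      ≡⟨ vertexCount-Ψ (3 + j) ⟩
    2 ^ n                  ≡⟨ 2^2^[1+k]≡[2^2^k]² (2 + j) ⟩
    2 ^ 2 ^ (2 + j) * 2 ^ 2 ^ (2 + j)
                           ≡⟨ cong₂ _*_ (vertexCount-Ψ (2 + j)) (vertexCount-Ψ (2 + j)) ⟨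
    v * v                  ∎
    where open ≡-Reasoning
  v≡16^m : v ≡ 16 ^ m
  v≡16^m = begin
    v                      ≡⟨ vertexCount-Ψ (2 + j) ⟩
    2 ^ (2 * (2 * m))      ≡⟨ cong (2 ^_) (*-assoc 2 2 m) ⟨
    2 ^ (4 * m)            ≡⟨ ^-*-assoc 2 4 m ⟨
    16 ^ m                 ∎
    where open ≡-Reasoning
  v>0 : 0 ℕ.< v
  v>0 = subst (0 ℕ.<_) (sym v≡16^m) (m^n>0 16 m)
  e≤vvv : edgeCount (Ψ (3 + j)) ≤ v * v * v
  e≤vvv = subst (λ w → edgeCount (Ψ (3 + j)) ≤ w * v) W≡vv (edgeCount-Ψ-suc-≤ (2 + j))
  vvC≤2E+vv : v * v * walks n (+ 0) ≤ 2 * edgeCount (Ω n) + v * v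
  vvC≤2E+vv = subst (λ w → w * walks n (+ 0) ≤ 2 * edgeCount (Ω n) + w)
                    (trans (sym (vertexCount-Ψ (3 + j))) W≡vv) (walks-≤-edgeCount-Ω n)
  2[Nv+1]≤C : 2 * (N * v + 1) ≤ walks n (+ 0)
  2[Nv+1]≤C = begin
    2 * (N * v + 1)        ≡⟨ cong (λ x → 2 * (N * x + 1)) v≡16^m ⟩
    2 * (N * 16 ^ m + 1)   ≤⟨ 2[N*16^m+1]≤70^m N m 2N+2≤4^m ⟩
    70 ^ m                 ≡⟨⟩  -- C(8, 4) = 70
    walks 8 (+ 0) ^ m      ≤⟨ walks-^-≤ 8 m ⟩
    walks (m * 8) (+ 0)    ≡⟨ cong (λ l → walks l (+ 0)) m*8≡n ⟩
    walks n (+ 0)          ∎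
    where
    open ≤-Reasoning
    m*8≡n : m * 8 ≡ n
    m*8≡n = trans (*-comm m 8) (sym (^-distribˡ-+-* 2 3 j))

archimedean : (ε : ℚ) → Positive ε → ∃[ N ] ((a b : ℕ) .{{_ : NonZero b}} → N * a ℕ.< b → + a / b < ε)
archimedean ε@(ℚ.mkℚ (+ suc p) q _) _ = suc q , a/b<ε
  where
  a/b<ε : (a b : ℕ) .{{_ : NonZero b}} → suc q * a ℕ.< b → + a / b < ε
  a/b<ε a b@(suc b-1) qa<b =
    ℚ.toℚᵘ-cancel-<
      (ℚᵘ.<-respˡ-≃ (ℚᵘ.≃-sym (ℚ.toℚᵘ-fromℚᵘ (ℚᵘ.mkℚᵘ (+ a) b-1)))
        (ℚᵘ.*<* (subst₂ ℤ._<_ (ℤ.pos-* a (suc q)) (ℤ.pos-* (suc p) b) (ℤ.+<+ cross))))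
    where
    cross : a * suc q ℕ.< suc p * b
    cross = begin-strict
      a * suc q   ≡⟨ *-comm a (suc q) ⟩
      suc q * a   <⟨ qa<b ⟩
      b           ≤⟨ m≤n*m b (suc p) ⟩
      suc p * b   ∎
      where open ≤-Reasoning

mainTheorem10 : (ε : ℚ) → Positive ε →
    ∃[ K ] ((k : ℕ) → K ≤ k →
      Σ (NonZero (edgeCount (Ω (2 ^ k)))) λ nz →
        _/_ (+ edgeCount (Ψ k)) (edgeCount (Ω (2 ^ k))) {{nz}} < ε)
mainTheorem10 ε ε>0 with archimedean ε ε>0
... | N , a/b<ε = 3 + (2 * N + 2) , ratio<ε
  where
  ratio<ε : (k : ℕ) → 3 + (2 * N + 2) ≤ k →
    Σ (NonZero (edgeCount (Ω (2 ^ k)))) λ nz →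
      _/_ (+ edgeCount (Ψ k)) (edgeCount (Ω (2 ^ k))) {{nz}} < ε
  ratio<ε (suc (suc (suc j))) (s≤s (s≤s (s≤s 2N+2≤j))) =
    nonZero , a/b<ε (edgeCount (Ψ (3 + j))) (edgeCount (Ω (2 ^ (3 + j)))) {{nonZero}} sparse
    where
    sparse : N * edgeCount (Ψ (3 + j)) ℕ.< edgeCount (Ω (2 ^ (3 + j)))
    sparse = N*edgeCount-Ψ<edgeCount-Ω N j (2N+2≤4^2^j N j 2N+2≤j)
    nonZero : NonZero (edgeCount (Ω (2 ^ (3 + j))))
    nonZero = >-nonZero (m<n⇒0<n sparse)
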